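{- Let $s\geq 4$ be an even integer and let $t\geq 3$ be an integer with $t \not\equiv 2, 4, 6, \dots, s-2 \pmod{s}$. Then \[ \sum_{n\geq 0} E_{s}^{t}(n)q^{n} = \frac{(q^{2};q^{2})_{\infty} (q^{t};q^{t})_{\infty} (q^{ts};q^{ts})_{\infty}}{(q;q)_{\infty} (q^{s};q^{s})_{\infty} (q^{2t};q^{2t})_{\infty}}. \]
   Context: $E_{s}^{t}(n)$ is the number of partitions of $n$ into parts that are not congruent to any of $2,4,6,\dots,s-2$ modulo $s$ and not congruent to any of $0$ and $t(2r+1)$, $r=0,1,\dots,s/2-1$, modulo $ts$. Notation: $(a;q)_{\infty}=\prod_{i\geq 0}(1-aq^{i})$. -}

module Defs where

open import Data.Nat as ℕ using (ℕ; zero; suc; _+_; _*_; _∸_; _≤_; _<_; _≥_)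
open import Data.Nat.DivMod using (_%_; _/_)
open import Data.Bool using (Bool; true; false; _∧_; not; if_then_else_)
open import Data.List using (List; []; _∷_; map; foldr; upTo; zipWith)
open import Data.Bool.ListAction using (all; any)
open import Data.Integer as ℤ using (ℤ; +_; -_)
open import Relation.Nullary.Decidable using (⌊_⌋)

-- Natural-number remainder, total in the modulus (m % 0 := m; only
-- used with nonzero moduli in the theorem).

_mod'_ : ℕ → ℕ → ℕ
n mod' zero  = n
n mod' suc m = n % suc m

_==_ : ℕ → ℕ → Bool
m == n = ⌊ m ℕ.≟ n ⌋

PS : Set
PS = ℕ → ℤ

oneS : PS
oneS zero    = + 1
oneS (suc _) = + 0

_⊛_ : PS → PS → PS
(f ⊛ g) n = csum n
  where
  csum : ℕ → ℤ
  csum m = Data.List.foldr ℤ._+_ (+ 0) (map (λ k → f k ℤ.* g (n ∸ k)) (upTo (suc m)))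

infixl 7 _⊛_

oneMinusQ^ : ℕ → PS
oneMinusQ^ e k = (if k == 0 then + 1 else + 0) ℤ.- (if k == e then + 1 else + 0)

prodS : List PS → PS
prodS = foldr _⊛_ oneS

-- (q^a ; q^a)_∞ = ∏_{i ≥ 0} (1 - q^{a(i+1)}).  For a ≥ 1 the factors with
-- i ≥ n have exponent > n, so the n-th coefficient of the infinite product
-- equals the n-th coefficient of the finite product over i < n + 1.
qPoch : ℕ → PS
qPoch a n = prodS (map (λ i → oneMinusQ^ (a * suc i)) (upTo (suc n))) n

-- Multiplicative inverse of a power series f with f 0 = 1:
-- b 0 = 1,  b (m+1) = - Σ_{k=1}^{m+1} f k * b (m+1-k).
-- invRev f m = [b m , b (m-1) , … , b 0].
invRev : PS → ℕ → List ℤ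
invRev f zero    = + 1 ∷ []
invRev f (suc m) =
  (- foldr ℤ._+_ (+ 0) (zipWith ℤ._*_ (map (λ k → f (suc k)) (upTo (suc m))) (invRev f m)))
  ∷ invRev f m

headOr0 : List ℤ → ℤ
headOr0 []      = + 0
headOr0 (x ∷ _) = x

invS : PS → PS
invS f n = headOr0 (invRev f n)

nonincr : List ℕ → Bool
nonincr []           = true
nonincr (x ∷ [])     = true
nonincr (x ∷ y ∷ xs) = ⌊ y ℕ.≤? x ⌋ ∧ nonincr (y ∷ xs)

isPartitionOf : ℕ → List ℕ → Bool
isPartitionOf n ps = all (λ p → ⌊ 1 ℕ.≤? p ⌋) ps ∧ nonincr ps ∧ (foldr _+_ 0 ps == n)

allowedPart : ℕ → ℕ → ℕ → Bool
allowedPart s t p =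
  not (any (λ j → (p mod' s) == (2 * suc j)) (upTo (s / 2 ∸ 1)))
  ∧ not ((p mod' (t * s)) == 0)
  ∧ not (any (λ r → (p mod' (t * s)) == (t * (2 * r + 1))) (upTo (s / 2)))

isEPartition : ℕ → ℕ → ℕ → List ℕ → Bool
isEPartition s t n ps = isPartitionOf n ps ∧ all (allowedPart s t) ps

{-# OPTIONS --safe #-}
-- Write ∏ S for the product of the factors 1 - q^p over the parts p ∈ S. Its reciprocal
-- generates the partitions into parts from S: partitions with parts at most k either avoid
-- k or contain it, which is the recurrence satisfied by the reciprocal of the truncated product.
-- If a ∣ b, the multiples of a are those of b together with those not divisible by b, so
-- (q^a; q^a)_∞ = ∏ {p : a ∣ p, b ∤ p} · (q^b; q^b)_∞. Now let B be the set of parts with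
-- p ≢ 2, 4, …, s - 2 (mod s) and p ≢ 0 (mod ts). As s is even, B is the disjoint union of the
-- odd numbers and of the multiples of s that are not multiples of ts. As t ≢ 2, 4, …, s - 2
-- (mod s), the odd multiples of t, i.e. the p ≡ t (2r + 1) (mod ts), lie in B, so B is also
-- the disjoint union of the allowed parts and the odd multiples of t. Comparing the two
-- factorisations of ∏ B gives
--   ∏ allowed · (q^t; q^t)_∞ / (q^2t; q^2t)_∞ = (q; q)_∞ / (q²; q²)_∞ · (q^s; q^s)_∞ / (q^ts; q^ts)_∞.
module Submission where

open import Defs
open import Data.Nat using (ℕ; _*_; _≤_; _<_; _/_)
open import Data.Nat.Divisibility using (_∣_)
open import Data.Nat.DivMod using (_%_)
open import Data.Integer using (+_)
open import Data.List using (List)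
open import Data.Bool using (T)
open import Data.Fin using (Fin)
open import Data.Product using (Σ; _×_; ∃-syntax)
open import Function.Bundles using (_↔_)
open import Relation.Nullary using (¬_)
open import Relation.Binary.PropositionalEquality using (_≡_)

open import Data.Nat as ℕ using (zero; suc; _+_; _∸_; s≤s; z≤n; _≤′_; ≤′-refl; ≤′-step; _≤ᵇ_; _≡ᵇ_; NonZero)
import Data.Nat.Properties as ℕ
open import Data.Nat.DivMod using (m≡m%n+[m/n]*n; m%n<n; m*[n/m]≡n; m%n*o≡m*o%[n*o]; %-congʳ)
open import Data.Nat.Divisibility
  using (divides; _∣?_; ∣-trans; n∣m*n; m∣m*n; *-monoʳ-∣; *-monoˡ-∣; *-cancelˡ-∣; 1∣_; ∣m+n∣m⇒∣n; ∣⇒≤; >⇒∤;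
         m%n≡0⇒n∣m; n∣m⇒m%n≡0; ∣n∣m%n⇒∣m; %-presˡ-∣)
open import Data.Nat.Induction using (<-rec)
open import Data.Nat.ListAction using (sum)
open import Data.Nat.Primality using (euclidsLemma; prime[2])
open import Data.Nat.Tactic.RingSolver using () renaming (solve-∀ to ℕ-solve-∀)
open import Data.Integer as ℤ using (ℤ; -_)
import Data.Integer.Properties as ℤ
open import Data.Integer.Tactic.RingSolver using (solve-∀)
open import Data.Bool using (Bool; true; false; not; _∧_; if_then_else_)
open import Data.Bool.ListAction using (all; any)
open import Data.Bool.Properties using (T-∧; T-irrelevant)
open import Data.Fin.Properties using (+↔⊎)
import Data.Fin as Fin
open import Data.List using ([]; _∷_; _∷ʳ_; foldr; map; upTo; applyUpTo; zipWith)
import Data.List.Properties as List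
open import Data.List.Relation.Unary.Any.Properties using (any⁺; any⁻)
open import Data.List.Membership.Propositional using (find; lose)
open import Data.List.Membership.Propositional.Properties using (∈-upTo⁺; ∈-upTo⁻)
open import Data.Product using (_,_; proj₁; proj₂)
open import Data.Sum using (_⊎_; inj₁; inj₂; [_,_]; [_,_]′)
open import Data.Sum.Function.Propositional using (_⊎-↔_)
open import Data.Empty using (⊥-elim)
open import Data.Unit using (⊤; tt)
open import Function using (_∘_; id; _⇔_; Equivalence; mk⇔)
open import Function.Bundles using (mk↔ₛ′)
open import Function.Properties.Inverse using (↔-trans)
open import Level using (0ℓ)
open import Algebra.Bundles using (CommutativeMonoid)
import Algebra.Properties.Monoid as MonoidProperties
import Algebra.Properties.CommutativeSemigroup as CommutativeSemigroupProperties
open import Relation.Binary.Bundles using (Setoid)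
open import Relation.Binary.PropositionalEquality
  using (refl; sym; trans; cong; cong₂; subst; subst₂; _≗_; _→-setoid_; module ≡-Reasoning)
open import Relation.Nullary using (Dec; yes; no; contradiction)
open import Relation.Nullary.Decidable using (T?; isYes; isYes≗does; toWitness; fromWitness; decidable-stable)
open import Relation.Unary using (Pred; Decidable; _⊆_; _≐_; _∪_; _∩_; ∁; Empty)
open import Relation.Unary.Properties using (_∩?_; ∁?)

open Equivalence using (to; from)

-- Finite sums

∑ : ℕ → (ℕ → ℤ) → ℤ
∑ zero    f = + 0
∑ (suc n) f = f 0 ℤ.+ ∑ n (f ∘ suc)

syntax ∑ n (λ k → e) = ∑[ k < n ] e

foldr-applyUpTo≡∑ : ∀ f n → foldr ℤ._+_ (+ 0) (applyUpTo f n) ≡ ∑ n f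
foldr-applyUpTo≡∑ f zero    = refl
foldr-applyUpTo≡∑ f (suc n) = cong (ℤ._+_ (f 0)) (foldr-applyUpTo≡∑ (f ∘ suc) n)

foldr-map-upTo≡∑ : ∀ f n → foldr ℤ._+_ (+ 0) (map f (upTo n)) ≡ ∑ n f
foldr-map-upTo≡∑ f n = trans (cong (foldr ℤ._+_ (+ 0)) (List.map-upTo f n)) (foldr-applyUpTo≡∑ f n)

∑-cong : ∀ n {f g} → (∀ k → k < n → f k ≡ g k) → ∑ n f ≡ ∑ n g
∑-cong zero    f≡g = refl
∑-cong (suc n) f≡g = cong₂ ℤ._+_ (f≡g 0 (s≤s z≤n)) (∑-cong n (λ k k<n → f≡g (suc k) (s≤s k<n)))

∑-distrib-+ : ∀ n f g → ∑[ k < n ] (f k ℤ.+ g k) ≡ ∑ n f ℤ.+ ∑ n g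
∑-distrib-+ zero    f g = refl
∑-distrib-+ (suc n) f g =
  trans (cong (ℤ._+_ (f 0 ℤ.+ g 0)) (∑-distrib-+ n (f ∘ suc) (g ∘ suc))) (medial (f 0) (g 0) _ _)
  where
  medial : ∀ a b c d → (a ℤ.+ b) ℤ.+ (c ℤ.+ d) ≡ (a ℤ.+ c) ℤ.+ (b ℤ.+ d)
  medial = solve-∀

*-distribˡ-∑ : ∀ c n f → c ℤ.* ∑ n f ≡ ∑[ k < n ] (c ℤ.* f k)
*-distribˡ-∑ c zero    f = ℤ.*-zeroʳ c
*-distribˡ-∑ c (suc n) f =
  trans (ℤ.*-distribˡ-+ c (f 0) _) (cong (ℤ._+_ (c ℤ.* f 0)) (*-distribˡ-∑ c n (f ∘ suc)))

∑-sucʳ : ∀ n f → ∑ (suc n) f ≡ ∑ n f ℤ.+ f n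
∑-sucʳ zero    f = ℤ.+-comm (f 0) (+ 0)
∑-sucʳ (suc n) f = trans (cong (ℤ._+_ (f 0)) (∑-sucʳ n (f ∘ suc))) (sym (ℤ.+-assoc (f 0) _ _))

∑-reverse : ∀ n f → ∑ n f ≡ ∑[ k < n ] f (n ∸ suc k)
∑-reverse zero    f = refl
∑-reverse (suc n) f = begin
  f 0 ℤ.+ ∑ n (f ∘ suc)                   ≡⟨ cong (ℤ._+_ (f 0)) (∑-reverse n (f ∘ suc)) ⟩
  f 0 ℤ.+ ∑[ k < n ] f (suc (n ∸ suc k))  ≡⟨ cong (ℤ._+_ (f 0)) (∑-cong n λ k k<n → cong f (ℕ.+-∸-assoc 1 k<n)) ⟨
  f 0 ℤ.+ ∑[ k < n ] f (n ∸ k)            ≡⟨ ℤ.+-comm (f 0) _ ⟩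
  ∑[ k < n ] f (n ∸ k) ℤ.+ f 0            ≡⟨ cong (λ i → ∑[ k < n ] f (n ∸ k) ℤ.+ f i) (ℕ.n∸n≡0 n) ⟨
  ∑[ k < n ] f (n ∸ k) ℤ.+ f (n ∸ n)      ≡⟨ ∑-sucʳ n (λ k → f (n ∸ k)) ⟨
  ∑[ k < suc n ] f (suc n ∸ suc k)        ∎
  where open ≡-Reasoning

neg-distrib-∑ : ∀ n f → ∑[ k < n ] (- f k) ≡ - ∑ n f
neg-distrib-∑ zero    f = refl
neg-distrib-∑ (suc n) f =
  trans (cong (ℤ._+_ (- f 0)) (neg-distrib-∑ n (f ∘ suc))) (sym (ℤ.neg-distrib-+ (f 0) _))

∑-distrib-- : ∀ n f g → ∑[ k < n ] (f k ℤ.- g k) ≡ ∑ n f ℤ.- ∑ n g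
∑-distrib-- n f g = trans (∑-distrib-+ n f (λ k → - g k)) (cong (ℤ._+_ (∑ n f)) (neg-distrib-∑ n g))

∑-zero : ∀ n → ∑[ k < n ] (+ 0) ≡ + 0
∑-zero zero    = refl
∑-zero (suc n) = trans (ℤ.+-identityˡ _) (∑-zero n)

-- Power series

q^_ : ℕ → PS
(q^ j) k = if k ℕ.≡ᵇ j then + 1 else + 0

0*x+y≡y : ∀ x y → + 0 ℤ.* x ℤ.+ y ≡ y
0*x+y≡y = solve-∀

∑-q^-< : ∀ {j n} x → j < n → ∑[ k < n ] ((q^ j) k ℤ.* x k) ≡ x j
∑-q^-< {zero}  {suc n} x _ =
  trans (cong₂ ℤ._+_ (ℤ.*-identityˡ (x 0)) (∑-cong n λ k _ → ℤ.*-zeroˡ (x (suc k))))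
        (trans (cong (ℤ._+_ (x 0)) (∑-zero n)) (ℤ.+-identityʳ (x 0)))
∑-q^-< {suc j} {suc n} x (s≤s j<n) =
  trans (0*x+y≡y (x 0) _) (∑-q^-< (λ k → x (suc k)) j<n)

∑-q^-≥ : ∀ {j n} x → n ≤ j → ∑[ k < n ] ((q^ j) k ℤ.* x k) ≡ + 0
∑-q^-≥ {j}     {zero}  x _ = refl
∑-q^-≥ {suc j} {suc n} x (s≤s n≤j) =
  trans (0*x+y≡y (x 0) _) (∑-q^-≥ (λ k → x (suc k)) n≤j)

oneMinusQ^≗1-q^ : ∀ e → oneMinusQ^ e ≗ λ k → (q^ 0) k ℤ.- (q^ e) k
oneMinusQ^≗1-q^ e k =
  cong₂ (λ a b → (if a then + 1 else + 0) ℤ.- (if b then + 1 else + 0)) (isYes≗does (k ℕ.≟ 0)) (isYes≗does (k ℕ.≟ e))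

-- The Cauchy product via ∑: unlike _⊛_, in degree n + 1 it unfolds to f 0 * g (n + 1) + cauchy (f ∘ suc) g n.
cauchy : PS → PS → PS
cauchy f g n = ∑[ k < suc n ] (f k ℤ.* g (n ∸ k))

⊛≗cauchy : ∀ f g → f ⊛ g ≗ cauchy f g
⊛≗cauchy f g n = foldr-map-upTo≡∑ (λ k → f k ℤ.* g (n ∸ k)) (suc n)

infix 4 _≈[_]_

_≈[_]_ : PS → ℕ → PS → Set
f ≈[ n ] g = ∀ k → k ≤ n → f k ≡ g k

≈[]-mono : ∀ {f g m n} → m ≤ n → f ≈[ n ] g → f ≈[ m ] g
≈[]-mono m≤n f≈g k k≤m = f≈g k (ℕ.≤-trans k≤m m≤n)

cauchy-congₙ : ∀ n {f f′ g g′} → f ≈[ n ] f′ → g ≈[ n ] g′ → cauchy f g n ≡ cauchy f′ g′ n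
cauchy-congₙ n f≈f′ g≈g′ = ∑-cong (suc n) λ k k<1+n →
  cong₂ ℤ._*_ (f≈f′ k (ℕ.≤-pred k<1+n)) (g≈g′ (n ∸ k) (ℕ.m∸n≤m n k))

cauchy-comm : ∀ f g → cauchy f g ≗ cauchy g f
cauchy-comm f g n = trans (∑-reverse (suc n) (λ k → f k ℤ.* g (n ∸ k))) (∑-cong (suc n) λ k k<1+n →
  trans (cong (λ i → f (n ∸ k) ℤ.* g i) (ℕ.m∸[m∸n]≡n (ℕ.≤-pred k<1+n))) (ℤ.*-comm (f (n ∸ k)) (g k)))

cauchy-linearˡ : ∀ c u v h n →
  cauchy (λ k → c ℤ.* u k ℤ.+ v k) h n ≡ c ℤ.* cauchy u h n ℤ.+ cauchy v h n
cauchy-linearˡ c u v h n = begin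
  ∑[ k < suc n ] ((c ℤ.* u k ℤ.+ v k) ℤ.* h (n ∸ k))
    ≡⟨ ∑-cong (suc n) (λ k _ → ℤ.*-distribʳ-+ (h (n ∸ k)) (c ℤ.* u k) (v k)) ⟩
  ∑[ k < suc n ] (c ℤ.* u k ℤ.* h (n ∸ k) ℤ.+ v k ℤ.* h (n ∸ k))
    ≡⟨ ∑-distrib-+ (suc n) (λ k → c ℤ.* u k ℤ.* h (n ∸ k)) (λ k → v k ℤ.* h (n ∸ k)) ⟩
  ∑[ k < suc n ] (c ℤ.* u k ℤ.* h (n ∸ k)) ℤ.+ cauchy v h n
    ≡⟨ cong (ℤ._+ cauchy v h n) (∑-cong (suc n) (λ k _ → ℤ.*-assoc c (u k) (h (n ∸ k)))) ⟩
  ∑[ k < suc n ] (c ℤ.* (u k ℤ.* h (n ∸ k))) ℤ.+ cauchy v h n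
    ≡⟨ cong (ℤ._+ cauchy v h n) (*-distribˡ-∑ c (suc n) (λ k → u k ℤ.* h (n ∸ k))) ⟨
  c ℤ.* cauchy u h n ℤ.+ cauchy v h n ∎
  where open ≡-Reasoning

-- Peeling off the constant term f 0 reduces associativity in degree n + 1 to degree n.
cauchy-assoc : ∀ f g h → cauchy (cauchy f g) h ≗ cauchy f (cauchy g h)
cauchy-assoc f g h zero = rearrange (f 0) (g 0) (h 0)
  where
  rearrange : ∀ a b c → (a ℤ.* b ℤ.+ + 0) ℤ.* c ℤ.+ + 0 ≡ a ℤ.* (b ℤ.* c ℤ.+ + 0) ℤ.+ + 0
  rearrange = solve-∀
cauchy-assoc f g h (suc n) = begin
  cauchy (cauchy f g) h (suc n)
    ≡⟨ cong (ℤ._+_ (cauchy f g 0 ℤ.* h (suc n))) (cauchy-linearˡ (f 0) (g ∘ suc) (cauchy (f ∘ suc) g) h n) ⟩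
  cauchy f g 0 ℤ.* h (suc n) ℤ.+ (f 0 ℤ.* cauchy (g ∘ suc) h n ℤ.+ cauchy (cauchy (f ∘ suc) g) h n)
    ≡⟨ cong (λ x → cauchy f g 0 ℤ.* h (suc n) ℤ.+ (f 0 ℤ.* cauchy (g ∘ suc) h n ℤ.+ x)) (cauchy-assoc (f ∘ suc) g h n) ⟩
  cauchy f g 0 ℤ.* h (suc n) ℤ.+ (f 0 ℤ.* cauchy (g ∘ suc) h n ℤ.+ cauchy (f ∘ suc) (cauchy g h) n)
    ≡⟨ rearrange (f 0) (g 0) (h (suc n)) _ _ ⟩
  cauchy f (cauchy g h) (suc n) ∎
  where
  open ≡-Reasoning
  rearrange : ∀ a b c x y → (a ℤ.* b ℤ.+ + 0) ℤ.* c ℤ.+ (a ℤ.* x ℤ.+ y) ≡ a ℤ.* (b ℤ.* c ℤ.+ x) ℤ.+ y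
  rearrange = solve-∀

cauchy-identityˡ : ∀ f → cauchy oneS f ≗ f
cauchy-identityˡ f n = begin
  + 1 ℤ.* f n ℤ.+ ∑[ k < n ] (+ 0 ℤ.* f (n ∸ suc k))
    ≡⟨ cong₂ ℤ._+_ (ℤ.*-identityˡ (f n)) (∑-cong n (λ k _ → ℤ.*-zeroˡ (f (n ∸ suc k)))) ⟩
  f n ℤ.+ ∑[ k < n ] (+ 0)
    ≡⟨ cong (ℤ._+_ (f n)) (∑-zero n) ⟩
  f n ℤ.+ + 0
    ≡⟨ ℤ.+-identityʳ (f n) ⟩
  f n ∎
  where open ≡-Reasoning

⊛-congₙ : ∀ n {f f′ g g′} → f ≈[ n ] f′ → g ≈[ n ] g′ → (f ⊛ g) n ≡ (f′ ⊛ g′) n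
⊛-congₙ n {f} {f′} {g} {g′} f≈f′ g≈g′ =
  trans (⊛≗cauchy f g n) (trans (cauchy-congₙ n f≈f′ g≈g′) (sym (⊛≗cauchy f′ g′ n)))

⊛-cong : ∀ {f f′ g g′} → f ≗ f′ → g ≗ g′ → f ⊛ g ≗ f′ ⊛ g′
⊛-cong f≗f′ g≗g′ n = ⊛-congₙ n (λ k _ → f≗f′ k) (λ k _ → g≗g′ k)

⊛-congˡ : ∀ f {g g′} → g ≗ g′ → f ⊛ g ≗ f ⊛ g′
⊛-congˡ f g≗g′ = ⊛-cong {f} (λ _ → refl) g≗g′

⊛-congʳ : ∀ g {f f′} → f ≗ f′ → f ⊛ g ≗ f′ ⊛ g
⊛-congʳ g f≗f′ = ⊛-cong {g = g} f≗f′ (λ _ → refl)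

⊛-comm : ∀ f g → f ⊛ g ≗ g ⊛ f
⊛-comm f g n = trans (⊛≗cauchy f g n) (trans (cauchy-comm f g n) (sym (⊛≗cauchy g f n)))

⊛-assoc : ∀ f g h → (f ⊛ g) ⊛ h ≗ f ⊛ (g ⊛ h)
⊛-assoc f g h n = begin
  ((f ⊛ g) ⊛ h) n           ≡⟨ ⊛≗cauchy (f ⊛ g) h n ⟩
  cauchy (f ⊛ g) h n        ≡⟨ cauchy-congₙ n {g = h} (λ k _ → ⊛≗cauchy f g k) (λ _ _ → refl) ⟩
  cauchy (cauchy f g) h n   ≡⟨ cauchy-assoc f g h n ⟩
  cauchy f (cauchy g h) n   ≡⟨ cauchy-congₙ n {f = f} (λ _ _ → refl) (λ k _ → ⊛≗cauchy g h k) ⟨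
  cauchy f (g ⊛ h) n        ≡⟨ ⊛≗cauchy f (g ⊛ h) n ⟨
  (f ⊛ (g ⊛ h)) n           ∎
  where open ≡-Reasoning

⊛-identityˡ : ∀ f → oneS ⊛ f ≗ f
⊛-identityˡ f n = trans (⊛≗cauchy oneS f n) (cauchy-identityˡ f n)

⊛-identityʳ : ∀ f → f ⊛ oneS ≗ f
⊛-identityʳ f n = trans (⊛-comm f oneS n) (⊛-identityˡ f n)

⊛-commutativeMonoid : CommutativeMonoid 0ℓ 0ℓ
⊛-commutativeMonoid = record
  { Carrier             = PS
  ; _≈_                 = _≗_
  ; _∙_                 = _⊛_
  ; ε                   = oneS
  ; isCommutativeMonoid = record
    { isMonoid = record
      { isSemigroup = record
        { isMagma = record
          { isEquivalence = Setoid.isEquivalence (ℕ →-setoid ℤ)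
          ; ∙-cong        = ⊛-cong
          }
        ; assoc = ⊛-assoc
        }
      ; identity = ⊛-identityˡ , ⊛-identityʳ
      }
    ; comm = ⊛-comm
    }
  }

open CommutativeMonoid ⊛-commutativeMonoid using (monoid; commutativeSemigroup)
open CommutativeSemigroupProperties commutativeSemigroup using (interchange; xy∙z≈x∙zy)
open import Algebra.Solver.CommutativeMonoid ⊛-commutativeMonoid using (solve; _⊜_) renaming (_⊕_ to infixl 7 _·_)

⊛-oneMinusQ^ : ∀ e f n → (f ⊛ oneMinusQ^ e) n ≡ f n ℤ.- ∑[ k < suc n ] ((q^ e) k ℤ.* f (n ∸ k))
⊛-oneMinusQ^ e f n = begin
  (f ⊛ oneMinusQ^ e) n
    ≡⟨ trans (⊛-comm f (oneMinusQ^ e) n) (⊛≗cauchy (oneMinusQ^ e) f n) ⟩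
  ∑[ k < suc n ] (oneMinusQ^ e k ℤ.* f (n ∸ k))
    ≡⟨ ∑-cong (suc n) (λ k _ → trans (cong (ℤ._* f (n ∸ k)) (oneMinusQ^≗1-q^ e k))
                                     (*-distribʳ-- ((q^ 0) k) ((q^ e) k) (f (n ∸ k)))) ⟩
  ∑[ k < suc n ] ((q^ 0) k ℤ.* f (n ∸ k) ℤ.- (q^ e) k ℤ.* f (n ∸ k))
    ≡⟨ ∑-distrib-- (suc n) (λ k → (q^ 0) k ℤ.* f (n ∸ k)) (λ k → (q^ e) k ℤ.* f (n ∸ k)) ⟩
  ∑[ k < suc n ] ((q^ 0) k ℤ.* f (n ∸ k)) ℤ.- ∑[ k < suc n ] ((q^ e) k ℤ.* f (n ∸ k))
    ≡⟨ cong (ℤ._- ∑[ k < suc n ] ((q^ e) k ℤ.* f (n ∸ k))) (∑-q^-< {n = suc n} (λ k → f (n ∸ k)) (s≤s z≤n)) ⟩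
  f n ℤ.- ∑[ k < suc n ] ((q^ e) k ℤ.* f (n ∸ k)) ∎
  where
  open ≡-Reasoning
  *-distribʳ-- : ∀ a b x → (a ℤ.- b) ℤ.* x ≡ a ℤ.* x ℤ.- b ℤ.* x
  *-distribʳ-- = solve-∀

⊛-oneMinusQ^-≤ : ∀ {e n} f → e ≤ n → (f ⊛ oneMinusQ^ e) n ≡ f n ℤ.- f (n ∸ e)
⊛-oneMinusQ^-≤ {e} {n} f e≤n =
  trans (⊛-oneMinusQ^ e f n) (cong (ℤ._-_ (f n)) (∑-q^-< {n = suc n} (λ k → f (n ∸ k)) (s≤s e≤n)))

⊛-oneMinusQ^-< : ∀ {e n} f → n < e → (f ⊛ oneMinusQ^ e) n ≡ f n
⊛-oneMinusQ^-< {e} {n} f n<e =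
  trans (⊛-oneMinusQ^ e f n) (trans (cong (ℤ._-_ (f n)) (∑-q^-≥ {n = suc n} (λ k → f (n ∸ k)) n<e)) (ℤ.+-identityʳ (f n)))

invRev≡applyUpTo : ∀ f m → invRev f m ≡ applyUpTo (λ k → invS f (m ∸ k)) (suc m)
invRev≡applyUpTo f zero    = refl
invRev≡applyUpTo f (suc m) = cong (invS f (suc m) ∷_) (invRev≡applyUpTo f m)

foldr-zipWith-applyUpTo≡∑ : ∀ a b n →
  foldr ℤ._+_ (+ 0) (zipWith ℤ._*_ (applyUpTo a n) (applyUpTo b n)) ≡ ∑[ k < n ] (a k ℤ.* b k)
foldr-zipWith-applyUpTo≡∑ a b zero    = refl
foldr-zipWith-applyUpTo≡∑ a b (suc n) = cong (ℤ._+_ (a 0 ℤ.* b 0)) (foldr-zipWith-applyUpTo≡∑ (a ∘ suc) (b ∘ suc) n)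

invS-suc : ∀ f m → invS f (suc m) ≡ - ∑[ k < suc m ] (f (suc k) ℤ.* invS f (m ∸ k))
invS-suc f m = cong -_ (begin
  foldr ℤ._+_ (+ 0) (zipWith ℤ._*_ (map (f ∘ suc) (upTo (suc m))) (invRev f m))
    ≡⟨ cong₂ (λ xs ys → foldr ℤ._+_ (+ 0) (zipWith ℤ._*_ xs ys)) (List.map-upTo (f ∘ suc) (suc m)) (invRev≡applyUpTo f m) ⟩
  foldr ℤ._+_ (+ 0) (zipWith ℤ._*_ (applyUpTo (f ∘ suc) (suc m)) (applyUpTo (λ k → invS f (m ∸ k)) (suc m)))
    ≡⟨ foldr-zipWith-applyUpTo≡∑ (f ∘ suc) (λ k → invS f (m ∸ k)) (suc m) ⟩
  ∑[ k < suc m ] (f (suc k) ℤ.* invS f (m ∸ k)) ∎)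
  where open ≡-Reasoning

invS-inverseˡ : ∀ f → f 0 ≡ + 1 → invS f ⊛ f ≗ oneS
invS-inverseˡ f f0≡1 zero    = trans (⊛≗cauchy (invS f) f 0) (trans (ℤ.+-identityʳ _) (trans (ℤ.*-identityˡ (f 0)) f0≡1))
invS-inverseˡ f f0≡1 (suc m) = begin
  (invS f ⊛ f) (suc m)
    ≡⟨ trans (⊛-comm (invS f) f (suc m)) (⊛≗cauchy f (invS f) (suc m)) ⟩
  f 0 ℤ.* invS f (suc m) ℤ.+ s
    ≡⟨ cong₂ (λ a b → a ℤ.* b ℤ.+ s) f0≡1 (invS-suc f m) ⟩
  + 1 ℤ.* (- s) ℤ.+ s
    ≡⟨ cancel s ⟩
  + 0 ∎
  where
  open ≡-Reasoning
  s : ℤ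
  s = ∑[ k < suc m ] (f (suc k) ℤ.* invS f (m ∸ k))
  cancel : ∀ x → + 1 ℤ.* (- x) ℤ.+ x ≡ + 0
  cancel = solve-∀

inverse-unique : ∀ {f x y} → x ⊛ f ≗ oneS → y ⊛ f ≗ oneS → x ≗ y
inverse-unique {f} {x} {y} x⊛f≗1 y⊛f≗1 = begin
  x              ≈⟨ introˡ y⊛f≗1 x ⟩
  (y ⊛ f) ⊛ x    ≈⟨ ⊛-assoc y f x ⟩
  y ⊛ (f ⊛ x)    ≈⟨ ⊛-cong {y} (λ _ → refl) (⊛-comm f x) ⟩
  y ⊛ (x ⊛ f)    ≈⟨ elimʳ x⊛f≗1 y ⟩
  y              ∎
  where
  open MonoidProperties monoid using (introˡ; elimʳ)
  open import Relation.Binary.Reasoning.Setoid (ℕ →-setoid ℤ)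

invS-cong-≈[] : ∀ n {f g} → f ≈[ n ] g → invS f ≈[ n ] invS g
invS-cong-≈[] n       f≈g zero    _ = refl
invS-cong-≈[] (suc n) {f} {g} f≈g (suc m) (s≤s m≤n) = begin
  invS f (suc m)
    ≡⟨ invS-suc f m ⟩
  - ∑[ k < suc m ] (f (suc k) ℤ.* invS f (m ∸ k))
    ≡⟨ cong -_ (∑-cong (suc m) λ k k<1+m → cong₂ ℤ._*_
         (f≈g (suc k) (ℕ.≤-trans k<1+m (s≤s m≤n)))
         (invS-cong-≈[] n {f} {g} (≈[]-mono (ℕ.n≤1+n n) f≈g) (m ∸ k) (ℕ.≤-trans (ℕ.m∸n≤m m k) m≤n))) ⟩
  - ∑[ k < suc m ] (g (suc k) ℤ.* invS g (m ∸ k))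
    ≡⟨ invS-suc g m ⟨
  invS g (suc m) ∎
  where open ≡-Reasoning

invS-cong : ∀ {f g} → f ≗ g → invS f ≗ invS g
invS-cong {f} {g} f≗g n = invS-cong-≈[] n {f} {g} (λ k _ → f≗g k) n ℕ.≤-refl

-- Products over sets of parts

factor : ∀ {A : Set} → Dec A → ℕ → PS
factor (yes _) p = oneMinusQ^ p
factor (no _)  p = oneS

module _ {P : Pred ℕ 0ℓ} (P? : Decidable P) where

  ∏≤ : ℕ → PS
  ∏≤ zero    = oneS
  ∏≤ (suc N) = ∏≤ N ⊛ factor (P? (suc N)) (suc N)

  -- The factors 1 - q^p with p > n do not affect the coefficient of q^n.
  ∏ : PS
  ∏ n = ∏≤ n n

  ∏≤-suc-∈ : ∀ {N} → P (suc N) → ∏≤ (suc N) ≗ ∏≤ N ⊛ oneMinusQ^ (suc N)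
  ∏≤-suc-∈ {N} p with P? (suc N)
  ... | yes _ = λ _ → refl
  ... | no ¬p = contradiction p ¬p

  ∏≤-suc-∉ : ∀ {N} → ¬ P (suc N) → ∏≤ (suc N) ≗ ∏≤ N
  ∏≤-suc-∉ {N} ¬p with P? (suc N)
  ... | yes p = contradiction p ¬p
  ... | no _  = ⊛-identityʳ (∏≤ N)

  ∏≤-suc-≈[] : ∀ {n N} → n ≤ N → ∏≤ (suc N) ≈[ n ] ∏≤ N
  ∏≤-suc-≈[] {n} {N} n≤N k k≤n with P? (suc N)
  ... | yes _ = ⊛-oneMinusQ^-< (∏≤ N) (s≤s (ℕ.≤-trans k≤n n≤N))
  ... | no _  = ⊛-identityʳ (∏≤ N) k

  ∏≤-stable : ∀ {n N} → n ≤′ N → ∏≤ N ≈[ n ] ∏≤ n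
  ∏≤-stable ≤′-refl          _ _   = refl
  ∏≤-stable (≤′-step n≤′N) k k≤n =
    trans (∏≤-suc-≈[] (ℕ.≤′⇒≤ n≤′N) k k≤n) (∏≤-stable n≤′N k k≤n)

  ∏≤≈[]∏ : ∀ {n N} → n ≤ N → ∏≤ N ≈[ n ] ∏
  ∏≤≈[]∏ n≤N k k≤n = ∏≤-stable (ℕ.≤⇒≤′ (ℕ.≤-trans k≤n n≤N)) k ℕ.≤-refl

  ∏≤-constant : ∀ N → ∏≤ N 0 ≡ + 1
  ∏≤-constant N = ∏≤-stable {0} {N} (ℕ.≤⇒≤′ z≤n) 0 z≤n

  ∏≤-skip : ∀ N j → (∀ i → i < j → ¬ P (suc (i + N))) → ∏≤ (j + N) ≗ ∏≤ N
  ∏≤-skip N zero    _    = λ _ → refl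
  ∏≤-skip N (suc j) skip n =
    trans (∏≤-suc-∉ (skip j ℕ.≤-refl) n) (∏≤-skip N j (λ i i<j → skip i (ℕ.m≤n⇒m≤1+n i<j)) n)

module _ {P Q R : Pred ℕ 0ℓ} (P? : Decidable P) (Q? : Decidable Q) (R? : Decidable R)
         (P≐Q∪R : P ≐ Q ∪ R) (Q∩R=∅ : Empty (Q ∩ R)) where

  factor-split : ∀ p → factor (P? p) p ≗ factor (Q? p) p ⊛ factor (R? p) p
  factor-split p with P? p | Q? p | R? p
  ... | _     | yes q | yes r = contradiction (q , r) (Q∩R=∅ p)
  ... | yes _ | yes _ | no _  = λ n → sym (⊛-identityʳ (oneMinusQ^ p) n)
  ... | yes _ | no _  | yes _ = λ n → sym (⊛-identityˡ (oneMinusQ^ p) n)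
  ... | no ¬p | yes q | no _  = contradiction (P≐Q∪R .proj₂ (inj₁ q)) ¬p
  ... | no ¬p | no _  | yes r = contradiction (P≐Q∪R .proj₂ (inj₂ r)) ¬p
  ... | yes p | no ¬q | no ¬r with P≐Q∪R .proj₁ p
  ...   | inj₁ q = contradiction q ¬q
  ...   | inj₂ r = contradiction r ¬r
  factor-split p | no _ | no _ | no _ = λ n → sym (⊛-identityˡ oneS n)

  ∏≤-split : ∀ N → ∏≤ P? N ≗ ∏≤ Q? N ⊛ ∏≤ R? N
  ∏≤-split zero    n = sym (⊛-identityˡ oneS n)
  ∏≤-split (suc N) n = trans
    (⊛-cong (∏≤-split N) (factor-split (suc N)) n)
    (interchange (∏≤ Q? N) (∏≤ R? N) (factor (Q? (suc N)) (suc N)) (factor (R? (suc N)) (suc N)) n)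

  ∏-split : ∏ P? ≗ ∏ Q? ⊛ ∏ R?
  ∏-split n = trans (∏≤-split n n) (⊛-congₙ n (∏≤≈[]∏ Q? ℕ.≤-refl) (∏≤≈[]∏ R? ℕ.≤-refl))

prodS-∷ʳ : ∀ xs x → prodS (xs ∷ʳ x) ≗ prodS xs ⊛ x
prodS-∷ʳ []       x n = trans (⊛-identityʳ x n) (sym (⊛-identityˡ x n))
prodS-∷ʳ (y ∷ xs) x n =
  trans (⊛-congˡ y (prodS-∷ʳ xs x) n) (sym (⊛-assoc y (prodS xs) x n))

qPoch≤ : ℕ → ℕ → PS
qPoch≤ a m = prodS (map (λ i → oneMinusQ^ (a * suc i)) (upTo m))

qPoch≤-suc : ∀ a m → qPoch≤ a (suc m) ≗ qPoch≤ a m ⊛ oneMinusQ^ (a * suc m)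
qPoch≤-suc a m n = begin
  prodS (map f (upTo (suc m))) n      ≡⟨ cong (λ xs → prodS (map f xs) n) (List.upTo-∷ʳ m) ⟨
  prodS (map f (upTo m ∷ʳ m)) n       ≡⟨ cong (λ xs → prodS xs n) (List.map-++ f (upTo m) (m ∷ [])) ⟩
  prodS (map f (upTo m) ∷ʳ f m) n     ≡⟨ prodS-∷ʳ (map f (upTo m)) (f m) n ⟩
  (qPoch≤ a m ⊛ f m) n                ∎
  where
  open ≡-Reasoning
  f : ℕ → PS
  f i = oneMinusQ^ (a * suc i)

-- Between consecutive multiples a m and a (m + 1) only the latter contributes a factor.
qPoch≤≗∏≤ : ∀ a′ m → qPoch≤ (suc a′) m ≗ ∏≤ (suc a′ ∣?_) (suc a′ * m)
qPoch≤≗∏≤ a′ zero    n = cong (λ N → ∏≤ (suc a′ ∣?_) N n) (sym (ℕ.*-zeroʳ a′))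
qPoch≤≗∏≤ a′ (suc m) n = begin
  qPoch≤ a (suc m) n                 ≡⟨ qPoch≤-suc a m n ⟩
  (qPoch≤ a m ⊛ oneMinusQ^ (a * suc m)) n
    ≡⟨ ⊛-congʳ (oneMinusQ^ (a * suc m)) (qPoch≤≗∏≤ a′ m) n ⟩
  (∏≤ (a ∣?_) (a * m) ⊛ oneMinusQ^ (a * suc m)) n
    ≡⟨ ⊛-congʳ (oneMinusQ^ (a * suc m)) (∏≤-skip (a ∣?_) (a * m) a′ a∤) n ⟨
  (∏≤ (a ∣?_) (a′ + a * m) ⊛ oneMinusQ^ (a * suc m)) n
    ≡⟨ cong (λ N → (∏≤ (a ∣?_) (a′ + a * m) ⊛ oneMinusQ^ N) n) (ℕ.*-suc a m) ⟩
  (∏≤ (a ∣?_) (a′ + a * m) ⊛ oneMinusQ^ (a + a * m)) n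
    ≡⟨ ∏≤-suc-∈ (a ∣?_) (subst (a ∣_) (ℕ.*-suc a m) (m∣m*n (suc m))) n ⟨
  ∏≤ (a ∣?_) (a + a * m) n
    ≡⟨ cong (λ N → ∏≤ (a ∣?_) N n) (ℕ.*-suc a m) ⟨
  ∏≤ (a ∣?_) (a * suc m) n ∎
  where
  open ≡-Reasoning
  a : ℕ
  a = suc a′
  a∤ : ∀ i → i < a′ → ¬ a ∣ suc (i + a * m)
  a∤ i i<a′ a∣ = >⇒∤ (s≤s i<a′) (∣m+n∣m⇒∣n (subst (a ∣_) (ℕ.+-comm (suc i) (a * m)) a∣) (m∣m*n m))

qPoch≗∏∣ : ∀ a .{{_ : ℕ.NonZero a}} → qPoch a ≗ ∏ (a ∣?_)
qPoch≗∏∣ (suc a′) n = trans (qPoch≤≗∏≤ a′ (suc n) n)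
  (∏≤≈[]∏ (suc a′ ∣?_) (ℕ.≤-trans (ℕ.n≤1+n n) (ℕ.m≤n*m (suc n) (suc a′))) n ℕ.≤-refl)

invS-qPoch-inverse : ∀ a .{{_ : NonZero a}} → invS (qPoch a) ⊛ qPoch a ≗ oneS
invS-qPoch-inverse a = invS-inverseˡ (qPoch a) (qPoch≗∏∣ a 0)

-- Counting partitions

Σ-T-≡ : ∀ {A : Set} {b : A → Bool} {x y : Σ A (T ∘ b)} → proj₁ x ≡ proj₁ y → x ≡ y
Σ-T-≡ {x = a , p} {y = .a , q} refl = cong (a ,_) (T-irrelevant p q)

Σ-T-cong : ∀ {A : Set} {b c : A → Bool} → (∀ a → T (b a) ⇔ T (c a)) → Σ A (T ∘ b) ↔ Σ A (T ∘ c)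
Σ-T-cong b⇔c = mk↔ₛ′ (λ (a , t) → a , b⇔c a .to t) (λ (a , t) → a , b⇔c a .from t)
  (λ _ → Σ-T-≡ refl) (λ _ → Σ-T-≡ refl)

Fin-+-↔ : ∀ {a b} {A B : Set} → Fin a ↔ A → Fin b ↔ B → Fin (a + b) ↔ (A ⊎ B)
Fin-+-↔ Fin↔A Fin↔B = ↔-trans +↔⊎ (Fin↔A ⊎-↔ Fin↔B)

⊎-emptyʳ : ∀ {A B : Set} → ¬ B → A ↔ (A ⊎ B)
⊎-emptyʳ ¬b = mk↔ₛ′ inj₁ [ id , ⊥-elim ∘ ¬b ] [ (λ _ → refl) , ⊥-elim ∘ ¬b ] (λ _ → refl)

module _ (P : ℕ → Bool) where

  P? : Decidable (T ∘ P)
  P? p = T? (P p)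

  -- Partitions of n into P-parts bounded by k; each part bounds the next, so parts are nonincreasing.
  isBoundedPartition : ℕ → ℕ → List ℕ → Bool
  isBoundedPartition k n []       = n ≡ᵇ 0
  isBoundedPartition k n (p ∷ ps) = (1 ≤ᵇ p) ∧ (p ≤ᵇ k) ∧ (p ≤ᵇ n) ∧ P p ∧ isBoundedPartition p (n ∸ p) ps

  BoundedPartitions : ℕ → ℕ → Set
  BoundedPartitions k n = Σ (List ℕ) (T ∘ isBoundedPartition k n)

  -- A partition with largest part exactly k + 1, represented by its remaining parts.
  LargestPartSuc : ℕ → ℕ → Set
  LargestPartSuc k n = Σ (List ℕ) (λ qs → T (isBoundedPartition (suc k) n (suc k ∷ qs)))

  record FirstPart (k n p : ℕ) : Set where
    constructor firstPart
    field
      positive : 1 ≤ p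
      ≤bound   : p ≤ k
      ≤total   : p ≤ n
      allowed  : T (P p)

  isBoundedPartition-∷⁻ : ∀ k n p ps → T (isBoundedPartition k n (p ∷ ps)) →
                          FirstPart k n p × T (isBoundedPartition p (n ∸ p) ps)
  isBoundedPartition-∷⁻ k n p _ t =
    let (a , t₁) = T-∧ {1 ≤ᵇ p} .to t
        (b , t₂) = T-∧ {p ≤ᵇ k} .to t₁
        (c , t₃) = T-∧ {p ≤ᵇ n} .to t₂
        (d , e)  = T-∧ {P p} .to t₃
    in firstPart (ℕ.≤ᵇ⇒≤ 1 p a) (ℕ.≤ᵇ⇒≤ p k b) (ℕ.≤ᵇ⇒≤ p n c) d , e

  isBoundedPartition-∷⁺ : ∀ k n p ps → FirstPart k n p → T (isBoundedPartition p (n ∸ p) ps) →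
                          T (isBoundedPartition k n (p ∷ ps))
  isBoundedPartition-∷⁺ k n p _ (firstPart a b c d) e =
    T-∧ {1 ≤ᵇ p} .from (ℕ.≤⇒≤ᵇ a , T-∧ {p ≤ᵇ k} .from (ℕ.≤⇒≤ᵇ b ,
      T-∧ {p ≤ᵇ n} .from (ℕ.≤⇒≤ᵇ c , T-∧ {P p} .from (d , e))))

  open FirstPart

  isBoundedPartition-mono : ∀ {k k′} n ps → k ≤ k′ → T (isBoundedPartition k n ps) → T (isBoundedPartition k′ n ps)
  isBoundedPartition-mono n []       _    t = t
  isBoundedPartition-mono {k} {k′} n (p ∷ ps) k≤k′ t =
    let (firstPart 1≤p p≤k p≤n Pp , e) = isBoundedPartition-∷⁻ k n p ps t
    in isBoundedPartition-∷⁺ k′ n p ps (firstPart 1≤p (ℕ.≤-trans p≤k k≤k′) p≤n Pp) e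

  BoundedPartitions-suc-↔ : ∀ k n → (BoundedPartitions k n ⊎ LargestPartSuc k n) ↔ BoundedPartitions (suc k) n
  BoundedPartitions-suc-↔ k n = mk↔ₛ′ join split join-split split-join
    where
    split-∷ : ∀ p qs → T (isBoundedPartition (suc k) n (p ∷ qs)) → Dec (p ≤ k) → BoundedPartitions k n ⊎ LargestPartSuc k n
    split-∷ p qs t (yes p≤k) =
      let (firstPart 1≤p _ p≤n Pp , e) = isBoundedPartition-∷⁻ (suc k) n p qs t
      in inj₁ (p ∷ qs , isBoundedPartition-∷⁺ k n p qs (firstPart 1≤p p≤k p≤n Pp) e)
    split-∷ p qs t (no p≰k)  = inj₂ (qs , subst (λ x → T (isBoundedPartition (suc k) n (x ∷ qs)))
                                              (ℕ.≤-antisym (isBoundedPartition-∷⁻ (suc k) n p qs t .proj₁ .≤bound) (ℕ.≰⇒> p≰k)) t)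

    split : BoundedPartitions (suc k) n → BoundedPartitions k n ⊎ LargestPartSuc k n
    split ([]     , t) = inj₁ ([] , t)
    split (p ∷ qs , t) = split-∷ p qs t (p ℕ.≤? k)

    join : BoundedPartitions k n ⊎ LargestPartSuc k n → BoundedPartitions (suc k) n
    join (inj₁ (ps , t)) = ps , isBoundedPartition-mono n ps (ℕ.n≤1+n k) t
    join (inj₂ (qs , t)) = suc k ∷ qs , t

    split-join : ∀ x → split (join x) ≡ x
    split-join (inj₁ ([]     , t)) = refl
    split-join (inj₁ (p ∷ qs , t)) with p ℕ.≤? k
    ... | yes _   = cong inj₁ (Σ-T-≡ refl)
    ... | no  p≰k = contradiction (isBoundedPartition-∷⁻ k n p qs t .proj₁ .≤bound) p≰k
    split-join (inj₂ (qs , t)) with suc k ℕ.≤? k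
    ... | yes 1+k≤k = contradiction 1+k≤k (ℕ.1+n≰n)
    ... | no  _     = cong inj₂ (Σ-T-≡ refl)

    join-split : ∀ x → join (split x) ≡ x
    join-split ([]     , t) = refl
    join-split (p ∷ qs , t) with p ℕ.≤? k
    ... | yes _   = Σ-T-≡ refl
    ... | no  p≰k =
      Σ-T-≡ (cong (_∷ qs) (ℕ.≤-antisym (ℕ.≰⇒> p≰k) (isBoundedPartition-∷⁻ (suc k) n p qs t .proj₁ .≤bound)))

  LargestPartSuc-↔ : ∀ {k n} → T (P (suc k)) → suc k ≤ n → BoundedPartitions (suc k) (n ∸ suc k) ↔ LargestPartSuc k n
  LargestPartSuc-↔ {k} {n} p 1+k≤n = Σ-T-cong λ qs →
    mk⇔ (isBoundedPartition-∷⁺ (suc k) n (suc k) qs (firstPart (s≤s z≤n) ℕ.≤-refl 1+k≤n p))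
        (proj₂ ∘ isBoundedPartition-∷⁻ (suc k) n (suc k) qs)

  LargestPartSuc-empty : ∀ {k n} → ¬ (T (P (suc k)) × suc k ≤ n) → ¬ LargestPartSuc k n
  LargestPartSuc-empty {k} {n} ¬p (qs , t) = let (h , _) = isBoundedPartition-∷⁻ (suc k) n (suc k) qs t in ¬p (h .allowed , h .≤total)

  gf≤ : ℕ → PS
  gf≤ k = invS (∏≤ P? k)

  gf≤-inverse : ∀ k → gf≤ k ⊛ ∏≤ P? k ≗ oneS
  gf≤-inverse k = invS-inverseˡ (∏≤ P? k) (∏≤-constant P? k)

  gf≤-zero : gf≤ 0 ≗ oneS
  gf≤-zero = inverse-unique {oneS} (gf≤-inverse 0) (⊛-identityˡ oneS)

  gf≤-suc-∉ : ∀ {k} → ¬ T (P (suc k)) → gf≤ (suc k) ≗ gf≤ k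
  gf≤-suc-∉ ¬p = invS-cong (∏≤-suc-∉ P? ¬p)

  gf≤-suc-∈ : ∀ {k} → T (P (suc k)) → gf≤ (suc k) ⊛ oneMinusQ^ (suc k) ≗ gf≤ k
  gf≤-suc-∈ {k} p = inverse-unique {∏≤ P? k} cancel (gf≤-inverse k)
    where
    cancel : (gf≤ (suc k) ⊛ oneMinusQ^ (suc k)) ⊛ ∏≤ P? k ≗ oneS
    cancel n = begin
      ((gf≤ (suc k) ⊛ oneMinusQ^ (suc k)) ⊛ ∏≤ P? k) n  ≡⟨ xy∙z≈x∙zy (gf≤ (suc k)) (oneMinusQ^ (suc k)) (∏≤ P? k) n ⟩
      (gf≤ (suc k) ⊛ (∏≤ P? k ⊛ oneMinusQ^ (suc k))) n  ≡⟨ ⊛-congˡ (gf≤ (suc k)) (∏≤-suc-∈ P? p) n ⟨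
      (gf≤ (suc k) ⊛ ∏≤ P? (suc k)) n                  ≡⟨ gf≤-inverse (suc k) n ⟩
      oneS n                                          ∎
      where open ≡-Reasoning

  gf≤-suc-≤ : ∀ {k n} → T (P (suc k)) → suc k ≤ n → gf≤ (suc k) n ≡ gf≤ k n ℤ.+ gf≤ (suc k) (n ∸ suc k)
  gf≤-suc-≤ {k} {n} p 1+k≤n = begin
    a                     ≡⟨ a≡[a-b]+b a b ⟩
    (a ℤ.- b) ℤ.+ b       ≡⟨ cong (ℤ._+ b) (⊛-oneMinusQ^-≤ (gf≤ (suc k)) 1+k≤n) ⟨
    (gf≤ (suc k) ⊛ oneMinusQ^ (suc k)) n ℤ.+ b  ≡⟨ cong (ℤ._+ b) (gf≤-suc-∈ p n) ⟩
    gf≤ k n ℤ.+ b           ∎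
    where
    open ≡-Reasoning
    a b : ℤ
    a = gf≤ (suc k) n
    b = gf≤ (suc k) (n ∸ suc k)
    a≡[a-b]+b : ∀ a b → a ≡ (a ℤ.- b) ℤ.+ b
    a≡[a-b]+b = solve-∀

  gf≤-suc-> : ∀ {k n} → T (P (suc k)) → n < suc k → gf≤ (suc k) n ≡ gf≤ k n
  gf≤-suc-> {k} {n} p n<1+k = trans (sym (⊛-oneMinusQ^-< (gf≤ (suc k)) n<1+k)) (gf≤-suc-∈ p n)

  CountMatches : ℕ → ℕ → Set
  CountMatches k n = ∃[ m ] (Fin m ↔ BoundedPartitions k n) × (+ m ≡ gf≤ k n)

  countMatches-zero : ∀ n → CountMatches 0 n
  countMatches-zero zero =
    1 , mk↔ₛ′ (λ _ → [] , _) (λ _ → Fin.zero) only-[] (λ { Fin.zero → refl ; (Fin.suc ()) }) , sym (gf≤-zero 0)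
    where
    only-[] : ∀ x → ([] , _) ≡ x
    only-[] ([]     , _) = refl
    only-[] (p ∷ qs , t) =
      let (h , _) = isBoundedPartition-∷⁻ 0 0 p qs t in contradiction (ℕ.≤-trans (h .positive) (h .≤bound)) λ ()
  countMatches-zero (suc n) =
    0 , mk↔ₛ′ (λ ()) (⊥-elim ∘ no-partition) (λ x → contradiction x no-partition) (λ ()) , sym (gf≤-zero (suc n))
    where
    no-partition : ¬ BoundedPartitions 0 (suc n)
    no-partition (p ∷ qs , t) =
      let (h , _) = isBoundedPartition-∷⁻ 0 (suc n) p qs t in contradiction (ℕ.≤-trans (h .positive) (h .≤bound)) λ ()

  countMatches : ∀ k n → CountMatches k n
  countMatches zero    = countMatches-zero
  countMatches (suc k) = <-rec (CountMatches (suc k)) step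
    where
    step : ∀ n → (∀ {m} → m < n → CountMatches (suc k) m) → CountMatches (suc k) n
    step n rec = by-cases (countMatches k n) (T? (P (suc k))) (suc k ℕ.≤? n)
      where
      by-cases : CountMatches k n → Dec (T (P (suc k))) → Dec (suc k ≤ n) → CountMatches (suc k) n
      by-cases (m₁ , i₁ , e₁) (yes p) (yes 1+k≤n) =
        let (m₂ , i₂ , e₂) = rec (ℕ.∸-monoʳ-< {o = 0} (s≤s z≤n) 1+k≤n) in
        m₁ + m₂
        , ↔-trans (Fin-+-↔ i₁ (↔-trans i₂ (LargestPartSuc-↔ p 1+k≤n))) (BoundedPartitions-suc-↔ k n)
        , trans (cong₂ ℤ._+_ e₁ e₂) (sym (gf≤-suc-≤ {k} {n} p 1+k≤n))
      by-cases (m₁ , i₁ , e₁) (yes p) (no 1+k≰n) =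
        m₁
        , ↔-trans i₁ (↔-trans (⊎-emptyʳ (LargestPartSuc-empty {k} {n} λ (_ , 1+k≤n) → 1+k≰n 1+k≤n))
                              (BoundedPartitions-suc-↔ k n))
        , trans e₁ (sym (gf≤-suc-> {k} {n} p (ℕ.≰⇒> 1+k≰n)))
      by-cases (m₁ , i₁ , e₁) (no ¬p) _ =
        m₁
        , ↔-trans i₁ (↔-trans (⊎-emptyʳ (LargestPartSuc-empty {k} {n} λ (p , _) → ¬p p))
                              (BoundedPartitions-suc-↔ k n))
        , trans e₁ (sym (gf≤-suc-∉ ¬p n))

  HeadAtMost : ℕ → List ℕ → Set
  HeadAtMost k []      = ⊤
  HeadAtMost k (p ∷ _) = p ≤ k

  nonincr-∷⁺ : ∀ p qs → HeadAtMost p qs → T (nonincr qs) → T (nonincr (p ∷ qs))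
  nonincr-∷⁺ p []       _   _  = _
  nonincr-∷⁺ p (q ∷ qs) q≤p ni = T-∧ .from (fromWitness q≤p , ni)

  nonincr-∷⁻ : ∀ p qs → T (nonincr (p ∷ qs)) → HeadAtMost p qs × T (nonincr qs)
  nonincr-∷⁻ p []       _  = _ , _
  nonincr-∷⁻ p (q ∷ qs) ni = let (q≤p , ni′) = T-∧ {isYes (q ℕ.≤? p)} .to ni in toWitness q≤p , ni′

  isPartition : ℕ → List ℕ → Bool
  isPartition n ps = isPartitionOf n ps ∧ all P ps

  positive? : ℕ → Bool
  positive? p = isYes (1 ℕ.≤? p)

  isPartition-∷⁺ : ∀ {m} p qs → 1 ≤ p → T (P p) → HeadAtMost p qs → T (isPartition m qs) →
                   T (isPartition (p + m) (p ∷ qs))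
  isPartition-∷⁺ {m} p qs 1≤p Pp head t =
    let (part , allP) = T-∧ {isPartitionOf m qs} .to t
        (pos , rest)  = T-∧ {all positive? qs} .to part
        (ni , sum≡m)  = T-∧ {nonincr qs} .to rest
    in T-∧ {isPartitionOf (p + m) (p ∷ qs)} .from
         ( T-∧ {all positive? (p ∷ qs)} .from
             ( T-∧ {positive? p} .from (fromWitness 1≤p , pos)
             , T-∧ {nonincr (p ∷ qs)} .from (nonincr-∷⁺ p qs head ni , fromWitness (cong (_+_ p) (toWitness sum≡m))))
         , T-∧ {P p} .from (Pp , allP))

  isPartition-∷⁻ : ∀ n p qs → T (isPartition n (p ∷ qs)) →
    1 ≤ p × T (P p) × HeadAtMost p qs × p + sum qs ≡ n × T (isPartition (sum qs) qs)
  isPartition-∷⁻ n p qs t =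
    let (part , allP)   = T-∧ {isPartitionOf n (p ∷ qs)} .to t
        (pos , rest)    = T-∧ {all positive? (p ∷ qs)} .to part
        (1≤p , pos′)    = T-∧ {positive? p} .to pos
        (ni , sum≡n)    = T-∧ {nonincr (p ∷ qs)} .to rest
        (head , ni′)    = nonincr-∷⁻ p qs ni
        (Pp , allP′)    = T-∧ {P p} .to allP
    in toWitness 1≤p , Pp , head , toWitness sum≡n
     , T-∧ {isPartitionOf (sum qs) qs} .from
         (T-∧ {all positive? qs} .from (pos′ , T-∧ {nonincr qs} .from (ni′ , fromWitness refl)) , allP′)

  isBoundedPartition⇒isPartition : ∀ k n ps → T (isBoundedPartition k n ps) → T (isPartition n ps) × HeadAtMost k ps
  isBoundedPartition⇒isPartition k n []       t = T-∧ {isPartitionOf n []} .from (fromWitness (sym (ℕ.≡ᵇ⇒≡ n 0 t)) , _) , _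
  isBoundedPartition⇒isPartition k n (p ∷ qs) t =
    let (firstPart 1≤p p≤k p≤n Pp , e) = isBoundedPartition-∷⁻ k n p qs t
        (part , head) = isBoundedPartition⇒isPartition p (n ∸ p) qs e
    in subst (λ m → T (isPartition m (p ∷ qs))) (ℕ.m+[n∸m]≡n p≤n) (isPartition-∷⁺ p qs 1≤p Pp head part) , p≤k

  isPartition⇒isBoundedPartition : ∀ k n ps → T (isPartition n ps) → HeadAtMost k ps → T (isBoundedPartition k n ps)
  isPartition⇒isBoundedPartition k n []       t _   = ℕ.≡⇒≡ᵇ n 0 (sym (toWitness (T-∧ {isPartitionOf n []} .to t .proj₁)))
  isPartition⇒isBoundedPartition k n (p ∷ qs) t p≤k =
    let (1≤p , Pp , head , p+s≡n , part) = isPartition-∷⁻ n p qs t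
        s≡n∸p : sum qs ≡ n ∸ p
        s≡n∸p = trans (sym (ℕ.m+n∸m≡n p (sum qs))) (cong (_∸ p) p+s≡n)
    in isBoundedPartition-∷⁺ k n p qs (firstPart 1≤p p≤k (subst (p ≤_) p+s≡n (ℕ.m≤m+n p (sum qs))) Pp)
         (isPartition⇒isBoundedPartition p (n ∸ p) qs (subst (λ m → T (isPartition m qs)) s≡n∸p part) head)

  BoundedPartitions↔Partitions : ∀ n → BoundedPartitions n n ↔ Σ (List ℕ) (T ∘ isPartition n)
  BoundedPartitions↔Partitions n = Σ-T-cong λ ps → mk⇔
    (proj₁ ∘ isBoundedPartition⇒isPartition n n ps)
    (λ t → isPartition⇒isBoundedPartition n n ps t (head≤total ps t))
    where
    head≤total : ∀ ps → T (isPartition n ps) → HeadAtMost n ps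
    head≤total []       _ = _
    head≤total (p ∷ qs) t = let (_ , _ , _ , p+s≡n , _) = isPartition-∷⁻ n p qs t in subst (p ≤_) p+s≡n (ℕ.m≤m+n p (sum qs))

-- Allowed parts

T-not : ∀ b → T (not b) ⇔ (¬ T b)
T-not true  = mk⇔ (λ ()) (λ ¬t → ¬t tt)
T-not false = mk⇔ (λ _ ()) (λ _ → tt)

T-any-upTo : ∀ (f : ℕ → Bool) n → T (any f (upTo n)) ⇔ (∃[ j ] j < n × T (f j))
T-any-upTo f n = mk⇔
  (λ t → let (j , j∈ , fj) = find (any⁻ f (upTo n) t) in j , ∈-upTo⁻ j∈ , fj)
  (λ (j , j<n , fj) → any⁺ f (lose (∈-upTo⁺ j<n) fj))

mod'≡% : ∀ m n .{{_ : NonZero n}} → m mod' n ≡ m % n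
mod'≡% m (suc n) = refl

odd≡1+[/2]*2 : ∀ w → ¬ 2 ∣ w → w ≡ 1 + (w / 2) * 2
odd≡1+[/2]*2 w 2∤w = trans (m≡m%n+[m/n]*n w 2) (cong (_+ (w / 2) * 2) w%2≡1)
  where
  w%2≡1 : w % 2 ≡ 1
  w%2≡1 = ℕ.≤-antisym (ℕ.≤-pred (m%n<n w 2)) (ℕ.n≢0⇒n>0 (λ w%2≡0 → 2∤w (m%n≡0⇒n∣m w 2 w%2≡0)))

2∤1+2*r : ∀ r → ¬ 2 ∣ 1 + 2 * r
2∤1+2*r r 2∣ = contradiction (∣⇒≤ (∣m+n∣m⇒∣n 2∣2r+1 (m∣m*n r))) λ { (s≤s ()) }
  where
  2∣2r+1 : 2 ∣ 2 * r + 1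
  2∣2r+1 = subst (2 ∣_) (ℕ.+-comm 1 (2 * r)) 2∣

even-residue⇔ : ∀ {s} .{{_ : NonZero s}} → 2 ∣ s → ∀ p →
  (∃[ i ] 1 ≤ i × i < s / 2 × p % s ≡ 2 * i) ⇔ (2 ∣ p × ¬ s ∣ p)
even-residue⇔ {s} 2∣s p = mk⇔
  (λ (i , 1≤i , _ , p%s≡2i) →
      ∣n∣m%n⇒∣m 2∣s (subst (2 ∣_) (sym p%s≡2i) (m∣m*n i))
    , λ s∣p → contradiction (trans (sym p%s≡2i) (n∣m⇒m%n≡0 p s s∣p)) (ℕ.m<n⇒n≢0 (ℕ.*-monoʳ-< 2 1≤i)))
  (λ (2∣p , s∤p) → let divides i p%s≡i*2 = %-presˡ-∣ {n = s} 2∣p 2∣s in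
      i
    , ℕ.n≢0⇒n>0 (λ i≡0 → s∤p (m%n≡0⇒n∣m p s (trans p%s≡i*2 (cong (_* 2) i≡0))))
    , ℕ.*-cancelˡ-< 2 i (s / 2) (subst₂ _<_ (trans p%s≡i*2 (ℕ.*-comm i 2)) (sym (m*[n/m]≡n 2∣s)) (m%n<n p s))
    , trans p%s≡i*2 (ℕ.*-comm i 2))

infix 5 _∣∖_ _∣∖?_

_∣∖_ : ℕ → ℕ → Pred ℕ 0ℓ
a ∣∖ b = (a ∣_) ∩ ∁ (b ∣_)

_∣∖?_ : ∀ a b → Decidable (a ∣∖ b)
a ∣∖? b = (a ∣?_) ∩? ∁? (b ∣?_)

∣-split : ∀ {a b} → a ∣ b → (a ∣_) ≐ (a ∣∖ b) ∪ (b ∣_)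
∣-split {a} {b} a∣b = split , join
  where
  split : (a ∣_) ⊆ (a ∣∖ b) ∪ (b ∣_)
  split {p} a∣p with b ∣? p
  ... | yes b∣p = inj₂ b∣p
  ... | no  b∤p = inj₁ (a∣p , b∤p)
  join : (a ∣∖ b) ∪ (b ∣_) ⊆ (a ∣_)
  join (inj₁ (a∣p , _)) = a∣p
  join (inj₂ b∣p)       = ∣-trans a∣b b∣p

∣∖-disjoint : ∀ a b → Empty ((a ∣∖ b) ∩ (b ∣_))
∣∖-disjoint a b p ((_ , b∤p) , b∣p) = b∤p b∣p

suc<⇔<∸1 : ∀ {j} n → suc j < n ⇔ j < n ∸ 1
suc<⇔<∸1 zero    = mk⇔ (λ ()) (λ ())
suc<⇔<∸1 (suc n) = mk⇔ ℕ.≤-pred s≤s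

module AllowedParts {s t : ℕ} .{{_ : NonZero s}} .{{_ : NonZero t}} (2∣s : 2 ∣ s) where

  instance
    t*s≢0 : NonZero (t * s)
    t*s≢0 = ℕ.m*n≢0 t s
    s*t≢0 : NonZero (s * t)
    s*t≢0 = ℕ.m*n≢0 s t

  2∣ts : 2 ∣ t * s
  2∣ts = ∣-trans 2∣s (n∣m*n t)

  2t∣ts : 2 * t ∣ t * s
  2t∣ts = subst (_∣ t * s) (ℕ.*-comm t 2) (*-monoʳ-∣ t 2∣s)

  odd-multiple-residue⇔ : ∀ p →
    (∃[ r ] r < s / 2 × p % (t * s) ≡ t * (2 * r + 1)) ⇔ (t ∣ p × ¬ 2 * t ∣ p)
  odd-multiple-residue⇔ p = mk⇔
    (λ (r , _ , p%ts≡) →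
        ∣n∣m%n⇒∣m (m∣m*n s) (subst (t ∣_) (sym p%ts≡) (m∣m*n (2 * r + 1)))
      , λ 2t∣p → 2∤1+2*r r (subst (2 ∣_) (ℕ.+-comm (2 * r) 1) (*-cancelˡ-∣ t
          (subst₂ _∣_ (ℕ.*-comm 2 t) p%ts≡ (%-presˡ-∣ 2t∣p 2t∣ts)))))
    (λ (t∣p , 2t∤p) → let divides u p≡u*t = t∣p in
        subst (λ x → ∃[ r ] r < s / 2 × x % (t * s) ≡ t * (2 * r + 1)) (sym p≡u*t)
          (odd-multiple-residue u λ 2∣u → 2t∤p (subst (2 * t ∣_) (sym p≡u*t) (*-monoˡ-∣ t 2∣u))))
    where
    odd-multiple-residue : ∀ u → ¬ 2 ∣ u → ∃[ r ] r < s / 2 × (u * t) % (t * s) ≡ t * (2 * r + 1)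
    odd-multiple-residue u 2∤u = r , r<s/2 , u*t%ts≡
      where
      w r : ℕ
      w = u % s
      r = w / 2
      w≡1+r*2 : w ≡ 1 + r * 2
      w≡1+r*2 = odd≡1+[/2]*2 w (λ 2∣w → 2∤u (∣n∣m%n⇒∣m 2∣s 2∣w))
      r<s/2 : r < s / 2
      r<s/2 = ℕ.*-cancelʳ-< 2 r (s / 2) (begin-strict
        r * 2         <⟨ ℕ.n<1+n (r * 2) ⟩
        1 + r * 2     ≡⟨ w≡1+r*2 ⟨
        w             <⟨ m%n<n u s ⟩
        s             ≡⟨ m*[n/m]≡n 2∣s ⟨
        2 * (s / 2)   ≡⟨ ℕ.*-comm 2 (s / 2) ⟩
        s / 2 * 2     ∎)
        where open ℕ.≤-Reasoning
      u*t%ts≡ : (u * t) % (t * s) ≡ t * (2 * r + 1)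
      u*t%ts≡ = begin
        (u * t) % (t * s)   ≡⟨ %-congʳ {m = t * s} {n = s * t} (ℕ.*-comm t s) ⟩
        (u * t) % (s * t)   ≡⟨ m%n*o≡m*o%[n*o] u s t ⟨
        w * t               ≡⟨ cong (_* t) w≡1+r*2 ⟩
        (1 + r * 2) * t     ≡⟨ rearrange r t ⟩
        t * (2 * r + 1)     ∎
        where
        open ≡-Reasoning
        rearrange : ∀ r t → (1 + r * 2) * t ≡ t * (2 * r + 1)
        rearrange = ℕ-solve-∀

  T-nonzeroEvenResidue⇔ : ∀ p →
    T (any (λ j → (p mod' s) == (2 * suc j)) (upTo (s / 2 ∸ 1))) ⇔ (2 ∣∖ s) p
  T-nonzeroEvenResidue⇔ p = mk⇔
    (λ x → let (j , j< , e) = T-any-upTo _ _ .to x in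
      even-residue⇔ 2∣s p .to
        (suc j , s≤s z≤n , suc<⇔<∸1 (s / 2) .from j< , trans (sym (mod'≡% p s)) (toWitness e)))
    (λ 2∣∖s → from′ (even-residue⇔ 2∣s p .from 2∣∖s))
    where
    from′ : (∃[ i ] 1 ≤ i × i < s / 2 × p % s ≡ 2 * i) →
            T (any (λ j → (p mod' s) == (2 * suc j)) (upTo (s / 2 ∸ 1)))
    from′ (suc j , _ , i< , e) =
      T-any-upTo _ _ .from (j , suc<⇔<∸1 (s / 2) .to i< , fromWitness (trans (mod'≡% p s) e))

  T-zeroResidue⇔ : ∀ p → T ((p mod' (t * s)) == 0) ⇔ (t * s ∣ p)
  T-zeroResidue⇔ p = mk⇔
    (λ e → m%n≡0⇒n∣m p (t * s) (trans (sym (mod'≡% p (t * s))) (toWitness e)))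
    (λ ts∣p → fromWitness (trans (mod'≡% p (t * s)) (n∣m⇒m%n≡0 p (t * s) ts∣p)))

  T-oddMultipleResidue⇔ : ∀ p →
    T (any (λ r → (p mod' (t * s)) == (t * (2 * r + 1))) (upTo (s / 2))) ⇔ (t ∣∖ 2 * t) p
  T-oddMultipleResidue⇔ p = mk⇔
    (λ c → let (r , r< , e) = T-any-upTo _ _ .to c in
      odd-multiple-residue⇔ p .to (r , r< , trans (sym (mod'≡% p (t * s))) (toWitness e)))
    (λ t∣∖2t → let (r , r< , e) = odd-multiple-residue⇔ p .from t∣∖2t in
      T-any-upTo _ _ .from (r , r< , fromWitness (trans (mod'≡% p (t * s)) e)))

  Allowed : Pred ℕ 0ℓ
  Allowed p = T (allowedPart s t p)

  -- The parts admitted by the first two conditions alone: p ≢ 2, 4, …, s − 2 (mod s) and p ≢ 0 (mod t s).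
  Coarse : Pred ℕ 0ℓ
  Coarse = ∁ (2 ∣∖ s) ∩ ∁ (t * s ∣_)

  Allowed⇔ : ∀ p → Allowed p ⇔ (Coarse p × ¬ (t ∣∖ 2 * t) p)
  Allowed⇔ p = mk⇔
    (λ a → let (¬X , rest) = T-∧ {not X} .to a
               (¬Z , ¬C)   = T-∧ {not Z} .to rest
           in (T-not X .to ¬X ∘ X⇔ .from , T-not Z .to ¬Z ∘ Z⇔ .from) , T-not C .to ¬C ∘ C⇔ .from)
    (λ ((¬x , ¬z) , ¬c) → T-∧ {not X} .from
      ( T-not X .from (¬x ∘ X⇔ .to)
      , T-∧ {not Z} .from (T-not Z .from (¬z ∘ Z⇔ .to) , T-not C .from (¬c ∘ C⇔ .to))))
    where
    X Z C : Bool
    X = any (λ j → (p mod' s) == (2 * suc j)) (upTo (s / 2 ∸ 1))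
    Z = (p mod' (t * s)) == 0
    C = any (λ r → (p mod' (t * s)) == (t * (2 * r + 1))) (upTo (s / 2))
    X⇔ : T X ⇔ (2 ∣∖ s) p
    X⇔ = T-nonzeroEvenResidue⇔ p
    Z⇔ : T Z ⇔ (t * s ∣ p)
    Z⇔ = T-zeroResidue⇔ p
    C⇔ : T C ⇔ (t ∣∖ 2 * t) p
    C⇔ = T-oddMultipleResidue⇔ p

  Coarse≐Odd∪[s∣∖ts] : Coarse ≐ (1 ∣∖ 2) ∪ (s ∣∖ t * s)
  Coarse≐Odd∪[s∣∖ts] = split , join
    where
    split : Coarse ⊆ (1 ∣∖ 2) ∪ (s ∣∖ t * s)
    split {p} (¬2∣∖s , ts∤p) with 2 ∣? p
    ... | no  2∤p = inj₁ (1∣ p , 2∤p)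
    ... | yes 2∣p = inj₂ (decidable-stable (s ∣? p) (λ s∤p → ¬2∣∖s (2∣p , s∤p)) , ts∤p)
    join : (1 ∣∖ 2) ∪ (s ∣∖ t * s) ⊆ Coarse
    join (inj₁ (_ , 2∤p))    = (λ (2∣p , _) → 2∤p 2∣p) , (λ ts∣p → 2∤p (∣-trans 2∣ts ts∣p))
    join (inj₂ (s∣p , ts∤p)) = (λ (_ , s∤p) → s∤p s∣p) , ts∤p

  Odd∩[s∣∖ts]-empty : Empty ((1 ∣∖ 2) ∩ (s ∣∖ t * s))
  Odd∩[s∣∖ts]-empty p ((_ , 2∤p) , (s∣p , _)) = 2∤p (∣-trans 2∣s s∣p)

  Allowed∩[t∣∖2t]-empty : Empty (Allowed ∩ (t ∣∖ 2 * t))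
  Allowed∩[t∣∖2t]-empty p (a , c) = Allowed⇔ p .to a .proj₂ c

  -- An odd multiple u t is either odd, or t is even and then s ∣ t ∣ u t; in both cases u t ≢ 2, 4, …, s − 2 (mod s).
  Coarse≐Allowed∪[t∣∖2t] : (2 ∣ t → s ∣ t) → Coarse ≐ Allowed ∪ (t ∣∖ 2 * t)
  Coarse≐Allowed∪[t∣∖2t] 2∣t⇒s∣t = split , join
    where
    split : Coarse ⊆ Allowed ∪ (t ∣∖ 2 * t)
    split {p} c with (t ∣∖? 2 * t) p
    ... | yes c′ = inj₂ c′
    ... | no ¬c′ = inj₁ (Allowed⇔ p .from (c , ¬c′))
    join : Allowed ∪ (t ∣∖ 2 * t) ⊆ Coarse
    join {p} (inj₁ a) = Allowed⇔ p .to a .proj₁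
    join {p} (inj₂ (t∣p@(divides u p≡u*t) , 2t∤p)) = ¬2∣∖s , (λ ts∣p → 2t∤p (∣-trans 2t∣ts ts∣p))
      where
      ¬2∣∖s : ¬ (2 ∣∖ s) p
      ¬2∣∖s (2∣p , s∤p) = [ (λ 2∣u → 2t∤p (subst (2 * t ∣_) (sym p≡u*t) (*-monoˡ-∣ t 2∣u)))
                          , (λ 2∣t → s∤p (∣-trans (2∣t⇒s∣t 2∣t) t∣p)) ]′
                          (euclidsLemma u t prime[2] (subst (2 ∣_) p≡u*t 2∣p))

  ¬evenResidue⇒[2∣t⇒s∣t] : ¬ (∃[ j ] (1 ≤ j × j < s / 2 × t mod' s ≡ 2 * j)) → 2 ∣ t → s ∣ t
  ¬evenResidue⇒[2∣t⇒s∣t] hyp 2∣t = decidable-stable (s ∣? t) λ s∤t →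
    let (j , 1≤j , j< , e) = even-residue⇔ 2∣s t .from (2∣t , s∤t) in hyp (j , 1≤j , j< , trans (mod'≡% t s) e)

-- The product identity

qPoch-split : ∀ {a b} .{{_ : NonZero a}} .{{_ : NonZero b}} → a ∣ b → qPoch a ≗ ∏ (a ∣∖? b) ⊛ qPoch b
qPoch-split {a} {b} a∣b n = begin
  qPoch a n                      ≡⟨ qPoch≗∏∣ a n ⟩
  ∏ (a ∣?_) n                    ≡⟨ ∏-split (a ∣?_) (a ∣∖? b) (b ∣?_) (∣-split a∣b) (∣∖-disjoint a b) n ⟩
  (∏ (a ∣∖? b) ⊛ ∏ (b ∣?_)) n    ≡⟨ ⊛-congˡ (∏ (a ∣∖? b)) (qPoch≗∏∣ b) n ⟨
  (∏ (a ∣∖? b) ⊛ qPoch b) n      ∎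
  where open ≡-Reasoning

module GeneratingFunction {s t : ℕ} .{{_ : NonZero s}} .{{_ : NonZero t}} (2∣s : 2 ∣ s) (2∣t⇒s∣t : 2 ∣ t → s ∣ t) where

  open AllowedParts 2∣s

  instance
    2*t≢0 : NonZero (2 * t)
    2*t≢0 = ℕ.m*n≢0 2 t

  Allowed? : Decidable Allowed
  Allowed? p = T? (allowedPart s t p)

  ∏Allowed⊛∏[t∣∖2t] : ∏ Allowed? ⊛ ∏ (t ∣∖? 2 * t) ≗ ∏ (1 ∣∖? 2) ⊛ ∏ (s ∣∖? t * s)
  ∏Allowed⊛∏[t∣∖2t] n = trans
    (sym (∏-split Coarse? Allowed? (t ∣∖? 2 * t) (Coarse≐Allowed∪[t∣∖2t] 2∣t⇒s∣t) Allowed∩[t∣∖2t]-empty n))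
    (∏-split Coarse? (1 ∣∖? 2) (s ∣∖? t * s) Coarse≐Odd∪[s∣∖ts] Odd∩[s∣∖ts]-empty n)
    where
    Coarse? : Decidable Coarse
    Coarse? = ∁? (2 ∣∖? s) ∩? ∁? (t * s ∣?_)

  RHS : PS
  RHS = qPoch 2 ⊛ qPoch t ⊛ qPoch (t * s) ⊛ invS (qPoch 1) ⊛ invS (qPoch s) ⊛ invS (qPoch (2 * t))

  RHS⊛∏Allowed : RHS ⊛ ∏ Allowed? ≗ oneS
  RHS⊛∏Allowed = begin
    RHS ⊛ PA
      ≈⟨ solve 7 (λ q₂ qₜ qₜₛ i₁ iₛ i₂ₜ a →
             q₂ · qₜ · qₜₛ · i₁ · iₛ · i₂ₜ · a ⊜ (q₂ · qₜₛ · i₁ · iₛ · i₂ₜ) · (qₜ · a))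
           (λ _ → refl) q2 qt qts i1 is i2t PA ⟩
    W ⊛ (qt ⊛ PA)
      ≈⟨ ⊛-congˡ W (⊛-congʳ PA (qPoch-split (n∣m*n 2))) ⟩
    W ⊛ ((PC ⊛ q2t) ⊛ PA)
      ≈⟨ solve 4 (λ w c q a → w · ((c · q) · a) ⊜ (w · q) · (a · c)) (λ _ → refl) W PC q2t PA ⟩
    (W ⊛ q2t) ⊛ (PA ⊛ PC)
      ≈⟨ ⊛-congˡ (W ⊛ q2t) ∏Allowed⊛∏[t∣∖2t] ⟩
    (W ⊛ q2t) ⊛ (PO ⊛ PSN)
      ≈⟨ solve 8 (λ q₂ qₜₛ i₁ iₛ i₂ₜ q₂ₜ o n →
             q₂ · qₜₛ · i₁ · iₛ · i₂ₜ · q₂ₜ · (o · n)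
           ⊜ (i₁ · (o · q₂)) · (iₛ · (n · qₜₛ)) · (i₂ₜ · q₂ₜ))
           (λ _ → refl) q2 qts i1 is i2t q2t PO PSN ⟩
    (i1 ⊛ (PO ⊛ q2)) ⊛ (is ⊛ (PSN ⊛ qts)) ⊛ (i2t ⊛ q2t)
      ≈⟨ ⊛-congʳ (i2t ⊛ q2t) (⊛-cong (⊛-congˡ i1 (qPoch-split (1∣ 2))) (⊛-congˡ is (qPoch-split (n∣m*n t)))) ⟨
    (i1 ⊛ q1) ⊛ (is ⊛ qs) ⊛ (i2t ⊛ q2t)
      ≈⟨ ⊛-cong (⊛-cong (invS-qPoch-inverse 1) (invS-qPoch-inverse s)) (invS-qPoch-inverse (2 * t)) ⟩
    oneS ⊛ oneS ⊛ oneS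
      ≈⟨ ⊛-congʳ oneS (⊛-identityˡ oneS) ⟩
    oneS ⊛ oneS
      ≈⟨ ⊛-identityˡ oneS ⟩
    oneS ∎
    where
    open import Relation.Binary.Reasoning.Setoid (ℕ →-setoid ℤ)
    q1 q2 qs qt qts q2t i1 is i2t PA PC PO PSN W : PS
    q1 = qPoch 1 ; q2 = qPoch 2 ; qs = qPoch s ; qt = qPoch t ; qts = qPoch (t * s) ; q2t = qPoch (2 * t)
    i1 = invS q1 ; is = invS qs ; i2t = invS q2t
    PA = ∏ Allowed? ; PC = ∏ (t ∣∖? 2 * t) ; PO = ∏ (1 ∣∖? 2) ; PSN = ∏ (s ∣∖? t * s)
    W = q2 ⊛ qts ⊛ i1 ⊛ is ⊛ i2t

  invS-∏Allowed≗RHS : invS (∏ Allowed?) ≗ RHS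
  invS-∏Allowed≗RHS = inverse-unique (invS-inverseˡ (∏ Allowed?) refl) RHS⊛∏Allowed

  partitions-count : ∀ n → ∃[ m ] ((Fin m ↔ Σ (List ℕ) (λ ps → T (isEPartition s t n ps))) × + m ≡ RHS n)
  partitions-count n =
    let (m , Fin↔ , m≡gf≤) = countMatches (allowedPart s t) n n in
    m , ↔-trans Fin↔ (BoundedPartitions↔Partitions (allowedPart s t) n)
      , (begin
          + m                      ≡⟨ m≡gf≤ ⟩
          invS (∏≤ Allowed? n) n   ≡⟨ invS-cong-≈[] n {∏≤ Allowed? n} {∏ Allowed?} (∏≤≈[]∏ Allowed? ℕ.≤-refl) n ℕ.≤-refl ⟩
          invS (∏ Allowed?) n      ≡⟨ invS-∏Allowed≗RHS n ⟩
          RHS n                    ∎)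
    where open ≡-Reasoning

-- The bounds s ≥ 4 and t ≥ 3 are used only to know that s and t are nonzero.
theorem14 : (s t : ℕ) → 4 ≤ s → 2 ∣ s → 3 ≤ t
    → ¬ (∃[ j ] (1 ≤ j × j < s / 2 × t mod' s ≡ 2 * j))
    → (n : ℕ) → ∃[ m ] ((Fin m ↔ Σ (List ℕ) (λ ps → T (isEPartition s t n ps)))
        × + m ≡ (qPoch 2 ⊛ qPoch t ⊛ qPoch (t * s) ⊛ invS (qPoch 1) ⊛ invS (qPoch s) ⊛ invS (qPoch (2 * t))) n)
theorem14 s t 4≤s 2∣s 3≤t hyp =
  GeneratingFunction.partitions-count {{s≢0}} {{t≢0}} 2∣s
    (AllowedParts.¬evenResidue⇒[2∣t⇒s∣t] {{s≢0}} {{t≢0}} 2∣s hyp)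
  where
  s≢0 : NonZero s
  s≢0 = ℕ.>-nonZero (ℕ.<-≤-trans (ℕ.s≤s ℕ.z≤n) 4≤s)
  t≢0 : NonZero t
  t≢0 = ℕ.>-nonZero (ℕ.<-≤-trans (ℕ.s≤s ℕ.z≤n) 3≤t)
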